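{- Let $p$ be a prime and let $\Delta=HS_d=\operatorname{conv}\{\mathbf{0},v_1,\ldots,v_d\}$, where $v_1,\ldots,v_d$ are the columns of \[H=\begin{pmatrix}E_{d-r}&B\\0&p\,E_r\end{pmatrix}\] for some $B\in\mathbb{Z}^{(d-r)\times r}$ (so $\Delta$ is a $p$-power simplex with $\operatorname{cr}(\Delta)=r$). For $i\in[d]$ let $\Delta_i=\operatorname{conv}\{\mathbf{0},v_1,\ldots,v_{i-1},v_{i+1},\ldots,v_d\}$ be the facet of $\Delta$ opposite $v_i$, and let $G_{\Delta_i}$ be its quotient group defined with respect to the lattice $\mathbb{Z}^d\cap\operatorname{lin}(\Delta_i)$, i.e. $G_{\Delta_i}=(\mathbb{Z}^d\cap\operatorname{lin}(\Delta_i))/(\mathbb{Z}v_1+\cdots+\widehat{\mathbb{Z}v_i}+\cdots+\mathbb{Z}v_d)$. Then $G_{\Delta_j}\cong(\mathbb{Z}_p)^{r-1}$ for every $j\in\{d-r+1,\ldots,d\}$.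
   Context: $S_d=\operatorname{conv}\{\mathbf{0},e_1,\ldots,e_d\}$, $E_\ell$ the $\ell\times\ell$ identity matrix, $[d]=\{1,\ldots,d\}$, $\operatorname{lin}$ denotes linear span. For a lattice simplex $\Delta=AS_d$, $G_\Delta=\mathbb{Z}^d/A\mathbb{Z}^d$ and $\operatorname{cr}(\Delta)$ is the number of elementary divisors of $A$ larger than $1$. -}

module Defs where

open import Data.Nat using (ℕ; zero; suc; _∸_) renaming (_+_ to _+ℕ_)
open import Data.Integer using (ℤ; +_; _+_; _-_; _*_; 0ℤ; 1ℤ)
open import Data.Integer.Divisibility using (_∣_)
open import Data.Fin using (Fin; zero; suc; splitAt; _≟_)
open import Data.Sum using (_⊎_; inj₁; inj₂)
open import Data.Product using (Σ; _×_; _,_; proj₁)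
open import Relation.Binary.PropositionalEquality using (_≡_; _≢_)
open import Relation.Nullary using (yes; no)
open import Function.Bundles using (_⇔_)

ℤVec : ℕ → Set
ℤVec n = Fin n → ℤ

∑ : ∀ {n} → (Fin n → ℤ) → ℤ
∑ {zero}  f = 0ℤ
∑ {suc n} f = f zero + ∑ (λ i → f (suc i))

δ : ∀ {n} → ℤ → Fin n → Fin n → ℤ
δ a x y with x ≟ y
... | yes _ = a
... | no  _ = 0ℤ

-- The d×d matrix H = [[E_{d-r}, B],[0, p E_r]] with d = k + r, k = d - r.
-- H k r p B row col
H : (k r p : ℕ) → (Fin k → Fin r → ℤ) → Fin (k +ℕ r) → Fin (k +ℕ r) → ℤ
H k r p B row col with splitAt k row | splitAt k col
... | inj₁ a | inj₁ b = δ 1ℤ a b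
... | inj₁ a | inj₂ b = B a b
... | inj₂ a | inj₁ b = 0ℤ
... | inj₂ a | inj₂ b = δ (+ p) a b

v : (k r p : ℕ) → (Fin k → Fin r → ℤ) → Fin (k +ℕ r) → ℤVec (k +ℕ r)
v k r p B i row = H k r p B row i

lincomb : (k r p : ℕ) → (Fin k → Fin r → ℤ) → ℤVec (k +ℕ r) → ℤVec (k +ℕ r)
lincomb k r p B c row = ∑ (λ i → c i * v k r p B i row)

InLattice : (k r p : ℕ) → (Fin k → Fin r → ℤ) → Fin (k +ℕ r) → ℤVec (k +ℕ r) → Set
InLattice k r p B j x =
  Σ (ℤVec (k +ℕ r)) λ c → (c j ≡ 0ℤ) × (∀ row → x row ≡ lincomb k r p B c row)

-- x ∈ lin(Δ_j) = lin{v_i : i ≠ j} (for integer x: some nonzero integer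
-- multiple of x is an integer combination of the v_i, i ≠ j; i.e. x is a
-- rational combination after clearing denominators)
InLin : (k r p : ℕ) → (Fin k → Fin r → ℤ) → Fin (k +ℕ r) → ℤVec (k +ℕ r) → Set
InLin k r p B j x =
  Σ ℤ λ m → (m ≢ 0ℤ) × (Σ (ℤVec (k +ℕ r)) λ c →
     (c j ≡ 0ℤ) × (∀ row → m * x row ≡ lincomb k r p B c row))

M : (k r p : ℕ) → (Fin k → Fin r → ℤ) → Fin (k +ℕ r) → Set
M k r p B j = Σ (ℤVec (k +ℕ r)) (InLin k r p B j)

-- (ℤ_p)^n presented as ℤ^n modulo p: componentwise congruence
_≡[mod_]_ : ∀ {n} → ℤVec n → ℕ → ℤVec n → Set
z ≡[mod p ] w = ∀ i → (+ p) ∣ (z i - w i)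

_⊕_ : ∀ {n} → ℤVec n → ℤVec n → ℤVec n
(z ⊕ w) i = z i + w i

_⊖_ : ∀ {n} → ℤVec n → ℤVec n → ℤVec n
(z ⊖ w) i = z i - w i

-- G_{Δ_j} = M / L_j ≅ (ℤ_p)^n : there is a map f : M → ℤ^n such that
--  * f is additive (mod p),
--  * x ~ y in the quotient (x - y ∈ L_j)  iff  f x ≡ f y (mod p)
--    (well-defined and injective on the quotient),
--  * f is surjective onto (ℤ_p)^n.
-- i.e. f induces a group isomorphism M/L_j ≅ (ℤ/pℤ)^n.
GΔ≅ℤp^ : (k r p : ℕ) → (Fin k → Fin r → ℤ) → Fin (k +ℕ r) → ℕ → Set
GΔ≅ℤp^ k r p B j n =
  Σ (M k r p B j → ℤVec n) λ f →
    (∀ (x y s : M k r p B j) → (∀ row → proj₁ s row ≡ proj₁ x row + proj₁ y row) →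
        f s ≡[mod p ] (f x ⊕ f y))
  × (∀ (x y : M k r p B j) →
        InLattice k r p B j (proj₁ x ⊖ proj₁ y) ⇔ (f x ≡[mod p ] f y))
  × (∀ (z : ℤVec n) → Σ (M k r p B j) λ x → f x ≡[mod p ] z)

-- Column operations reduce H to the block form [[E, 0], [0, p E]]: an integer vector lies in
-- the lattice spanned by the columns iff its last r coordinates are divisible by p, and the
-- column coefficients can then be solved for by back-substitution. Dropping the column v_j
-- (j among the last r) additionally forces coordinate j to vanish, and so does membership in
-- lin(Δ_j). Hence reading off the last r coordinates other than j, modulo p, identifies
-- G_{Δ_j} with (ℤ_p)^{r-1}; primality of p is only used through p ≠ 0.
module Submission where

open import Defs
open import Data.Nat using (ℕ; _∸_; zero; suc) renaming (_+_ to _+ℕ_)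
open import Data.Nat.Primality using (Prime; prime⇒nonZero)
open import Data.Nat.Base using (≢-nonZero⁻¹)
open import Data.Integer using (ℤ; +_; -_; _+_; _-_; _*_; 0ℤ; 1ℤ)
open import Data.Integer.Properties
  using (+-identityˡ; +-identityʳ; +-assoc; +-inverseʳ; +-inverseˡ; *-zeroˡ; *-zeroʳ;
         *-identityʳ; *-comm; +-injective; i*j≡0⇒i≡0∨j≡0)
open import Data.Integer.Divisibility using (_∣_)
import Data.Integer.Divisibility.Signed as Signed
open import Data.Fin using (Fin; zero; suc; _↑ˡ_; _↑ʳ_; splitAt; _≟_; punchIn)
open import Data.Fin.Properties
  using (splitAt-↑ˡ; splitAt-↑ʳ; splitAt⁻¹-↑ˡ; splitAt⁻¹-↑ʳ; suc-injective; punchIn-punchOut)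
open import Data.Vec.Functional using (_++_; insertAt)
open import Data.Vec.Functional.Properties using (lookup-++ˡ; lookup-++ʳ; insertAt-lookup; insertAt-punchIn)
open import Data.Sum using (inj₁; inj₂)
open import Data.Product using (Σ; _,_; proj₁)
open import Data.Empty using (⊥-elim)
open import Relation.Binary.PropositionalEquality
open import Relation.Nullary using (yes; no)
open import Function using (_∘_)
open import Function.Bundles using (mk⇔)

∑-cong : ∀ {n} {f g : Fin n → ℤ} → (∀ i → f i ≡ g i) → ∑ f ≡ ∑ g
∑-cong {zero}  f≗g = refl
∑-cong {suc n} f≗g = cong₂ _+_ (f≗g zero) (∑-cong (λ i → f≗g (suc i)))

∑-zero : ∀ {n} {f : Fin n → ℤ} → (∀ i → f i ≡ 0ℤ) → ∑ f ≡ 0ℤ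
∑-zero {zero}  f≗0 = refl
∑-zero {suc n} f≗0 = cong₂ _+_ (f≗0 zero) (∑-zero (λ i → f≗0 (suc i)))

∑-single : ∀ {n} (f : Fin n → ℤ) a → (∀ i → i ≢ a → f i ≡ 0ℤ) → ∑ f ≡ f a
∑-single {suc n} f zero    vanish =
  trans (cong (_+_ (f zero)) (∑-zero (λ i → vanish (suc i) λ ()))) (+-identityʳ (f zero))
∑-single {suc n} f (suc a) vanish =
  trans (cong₂ _+_ (vanish zero λ ()) (∑-single (λ i → f (suc i)) a
                                         (λ i i≢a → vanish (suc i) (i≢a ∘ suc-injective))))
        (+-identityˡ (f (suc a)))

∑-↑ : ∀ m {n} (f : Fin (m +ℕ n) → ℤ) → ∑ f ≡ ∑ (λ a → f (a ↑ˡ n)) + ∑ (λ b → f (m ↑ʳ b))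
∑-↑ zero    f = sym (+-identityˡ (∑ f))
∑-↑ (suc m) f = trans (cong (_+_ (f zero)) (∑-↑ m (λ i → f (suc i)))) (sym (+-assoc (f zero) _ _))

∑-*δ : ∀ {n} (c : Fin n → ℤ) (u : ℤ) a → ∑ (λ i → c i * δ u a i) ≡ c a * u
∑-*δ c u a = trans (∑-single _ a off-diagonal) (cong (c a *_) δ-diagonal)
  where
  δ-diagonal : δ u a a ≡ u
  δ-diagonal with a ≟ a
  ... | yes _   = refl
  ... | no  a≢a = ⊥-elim (a≢a refl)
  off-diagonal : ∀ i → i ≢ a → c i * δ u a i ≡ 0ℤ
  off-diagonal i i≢a with a ≟ i
  ... | yes a≡i = ⊥-elim (i≢a (sym a≡i))
  ... | no  _   = *-zeroʳ (c i)

↑-elim : ∀ m n (P : Fin (m +ℕ n) → Set) → (∀ a → P (a ↑ˡ n)) → (∀ b → P (m ↑ʳ b)) → ∀ i → P i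
↑-elim m n P left right i with splitAt m i in eq
... | inj₁ a = subst P (splitAt⁻¹-↑ˡ eq) (left a)
... | inj₂ b = subst P (splitAt⁻¹-↑ʳ eq) (right b)

punchIn-elim : ∀ {n} (j : Fin (suc n)) (P : Fin (suc n) → Set) → P j → (∀ i → P (punchIn j i)) → ∀ b → P b
punchIn-elim j P Pj P-punchIn b with j ≟ b
... | yes refl = Pj
... | no  j≢b  = subst P (punchIn-punchOut j≢b) (P-punchIn _)

i*j≡0∧i≢0⇒j≡0 : ∀ {i j} → i ≢ 0ℤ → i * j ≡ 0ℤ → j ≡ 0ℤ
i*j≡0∧i≢0⇒j≡0 {i} i≢0 i*j≡0 with i*j≡0⇒i≡0∨j≡0 i i*j≡0
... | inj₁ i≡0 = ⊥-elim (i≢0 i≡0)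
... | inj₂ j≡0 = j≡0

quotient⇒∣ : ∀ {p z} q → z ≡ q * + p → + p ∣ z
quotient⇒∣ q eq = Signed.∣⇒∣ᵤ (Signed.divides q eq)

≡⇒∣- : ∀ {p a b} → a ≡ b → + p ∣ (a - b)
≡⇒∣- {p} {a} refl = quotient⇒∣ 0ℤ (trans (+-inverseʳ a) (sym (*-zeroˡ (+ p))))

module _ (k r p : ℕ) (B : Fin k → Fin r → ℤ) where

  private
    H-ll : ∀ a a' → H k r p B (a ↑ˡ r) (a' ↑ˡ r) ≡ δ 1ℤ a a'
    H-ll a a' rewrite splitAt-↑ˡ k a r | splitAt-↑ˡ k a' r = refl
    H-lr : ∀ a b → H k r p B (a ↑ˡ r) (k ↑ʳ b) ≡ B a b
    H-lr a b rewrite splitAt-↑ˡ k a r | splitAt-↑ʳ k r b = refl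
    H-rl : ∀ b a → H k r p B (k ↑ʳ b) (a ↑ˡ r) ≡ 0ℤ
    H-rl b a rewrite splitAt-↑ʳ k r b | splitAt-↑ˡ k a r = refl
    H-rr : ∀ b b' → H k r p B (k ↑ʳ b) (k ↑ʳ b') ≡ δ (+ p) b b'
    H-rr b b' rewrite splitAt-↑ʳ k r b | splitAt-↑ʳ k r b' = refl

  lincomb-↑ˡ : ∀ c a → lincomb k r p B c (a ↑ˡ r) ≡ c (a ↑ˡ r) + ∑ (λ b → c (k ↑ʳ b) * B a b)
  lincomb-↑ˡ c a = begin
    lincomb k r p B c (a ↑ˡ r)
      ≡⟨ ∑-↑ k _ ⟩
    ∑ (λ a' → c (a' ↑ˡ r) * H k r p B (a ↑ˡ r) (a' ↑ˡ r)) + ∑ (λ b → c (k ↑ʳ b) * H k r p B (a ↑ˡ r) (k ↑ʳ b))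
      ≡⟨ cong₂ _+_ (∑-cong (λ a' → cong (c (a' ↑ˡ r) *_) (H-ll a a')))
                   (∑-cong (λ b → cong (c (k ↑ʳ b) *_) (H-lr a b))) ⟩
    ∑ (λ a' → c (a' ↑ˡ r) * δ 1ℤ a a') + ∑ (λ b → c (k ↑ʳ b) * B a b)
      ≡⟨ cong (λ s → s + ∑ (λ b → c (k ↑ʳ b) * B a b)) (trans (∑-*δ (λ a' → c (a' ↑ˡ r)) 1ℤ a) (*-identityʳ (c (a ↑ˡ r)))) ⟩
    c (a ↑ˡ r) + ∑ (λ b → c (k ↑ʳ b) * B a b) ∎
    where open ≡-Reasoning

  lincomb-↑ʳ : ∀ c b → lincomb k r p B c (k ↑ʳ b) ≡ c (k ↑ʳ b) * + p
  lincomb-↑ʳ c b = begin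
    lincomb k r p B c (k ↑ʳ b)
      ≡⟨ ∑-↑ k _ ⟩
    ∑ (λ a → c (a ↑ˡ r) * H k r p B (k ↑ʳ b) (a ↑ˡ r)) + ∑ (λ b' → c (k ↑ʳ b') * H k r p B (k ↑ʳ b) (k ↑ʳ b'))
      ≡⟨ cong₂ _+_ (∑-zero (λ a → trans (cong (c (a ↑ˡ r) *_) (H-rl b a)) (*-zeroʳ (c (a ↑ˡ r)))))
                   (∑-cong (λ b' → cong (c (k ↑ʳ b') *_) (H-rr b b'))) ⟩
    0ℤ + ∑ (λ b' → c (k ↑ʳ b') * δ (+ p) b b')
      ≡⟨ trans (+-identityˡ _) (∑-*δ (λ b' → c (k ↑ʳ b')) (+ p) b) ⟩
    c (k ↑ʳ b) * + p ∎
    where open ≡-Reasoning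

  -- Back-substitution through the block-triangular H = [[E, B], [0, p E]].
  top-coefficients : ℤVec (k +ℕ r) → (Fin r → ℤ) → Fin k → ℤ
  top-coefficients x q a = x (a ↑ˡ r) - ∑ (λ b → q b * B a b)

  coefficients : ℤVec (k +ℕ r) → (Fin r → ℤ) → ℤVec (k +ℕ r)
  coefficients x q = top-coefficients x q ++ q

  lincomb-coefficients : ∀ x q → (∀ b → x (k ↑ʳ b) ≡ q b * + p) →
                         ∀ row → x row ≡ lincomb k r p B (coefficients x q) row
  lincomb-coefficients x q x≡qp = ↑-elim k r (λ row → x row ≡ lincomb k r p B c row) top bottom
    where
    c = coefficients x q
    c-↑ʳ : ∀ b → c (k ↑ʳ b) ≡ q b
    c-↑ʳ = lookup-++ʳ (top-coefficients x q) q
    top : ∀ a → x (a ↑ˡ r) ≡ lincomb k r p B c (a ↑ˡ r)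
    top a = sym (begin
      lincomb k r p B c (a ↑ˡ r)                                   ≡⟨ lincomb-↑ˡ c a ⟩
      c (a ↑ˡ r) + ∑ (λ b → c (k ↑ʳ b) * B a b)                     ≡⟨ cong₂ _+_ (lookup-++ˡ (top-coefficients x q) q a)
                                                                        (∑-cong (λ b → cong (_* B a b) (c-↑ʳ b))) ⟩
      x (a ↑ˡ r) - ∑ (λ b → q b * B a b) + ∑ (λ b → q b * B a b)    ≡⟨ +-assoc (x (a ↑ˡ r)) _ _ ⟩
      x (a ↑ˡ r) + (- ∑ (λ b → q b * B a b) + ∑ (λ b → q b * B a b)) ≡⟨ cong (_+_ (x (a ↑ˡ r))) (+-inverseˡ (∑ (λ b → q b * B a b))) ⟩
      x (a ↑ˡ r) + 0ℤ                                              ≡⟨ +-identityʳ _ ⟩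
      x (a ↑ˡ r)                                                   ∎)
      where open ≡-Reasoning
    bottom : ∀ b → x (k ↑ʳ b) ≡ lincomb k r p B c (k ↑ʳ b)
    bottom b = trans (x≡qp b) (sym (trans (lincomb-↑ʳ c b) (cong (_* + p) (c-↑ʳ b))))

  module _ (j : Fin r) where

    InLattice⇒divisible : ∀ {x} → InLattice k r p B (k ↑ʳ j) x → ∀ b → + p ∣ x (k ↑ʳ b)
    InLattice⇒divisible (c , _ , x≡lc) b = quotient⇒∣ (c (k ↑ʳ b)) (trans (x≡lc (k ↑ʳ b)) (lincomb-↑ʳ c b))

    divisible⇒InLattice : ∀ {x} → + p ≢ 0ℤ → (∀ b → + p ∣ x (k ↑ʳ b)) → x (k ↑ʳ j) ≡ 0ℤ →
                          InLattice k r p B (k ↑ʳ j) x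
    divisible⇒InLattice {x} p≢0 p∣x xⱼ≡0 =
      coefficients x q , trans (lookup-++ʳ (top-coefficients x q) q j) qⱼ≡0 , lincomb-coefficients x q x≡qp
      where
      q : Fin r → ℤ
      q b = Signed.quotient (Signed.∣ᵤ⇒∣ {+ p} {x (k ↑ʳ b)} (p∣x b))
      x≡qp : ∀ b → x (k ↑ʳ b) ≡ q b * + p
      x≡qp b = Signed._∣_.equality (Signed.∣ᵤ⇒∣ {+ p} {x (k ↑ʳ b)} (p∣x b))
      qⱼ≡0 : q j ≡ 0ℤ
      qⱼ≡0 = i*j≡0∧i≢0⇒j≡0 p≢0 (trans (*-comm (+ p) (q j)) (trans (sym (x≡qp j)) xⱼ≡0))

    InLin⇒vanishes : ∀ {x} → InLin k r p B (k ↑ʳ j) x → x (k ↑ʳ j) ≡ 0ℤ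
    InLin⇒vanishes {x} (m , m≢0 , c , cⱼ≡0 , mx≡lc) = i*j≡0∧i≢0⇒j≡0 m≢0 (begin
      m * x (k ↑ʳ j)             ≡⟨ mx≡lc (k ↑ʳ j) ⟩
      lincomb k r p B c (k ↑ʳ j) ≡⟨ lincomb-↑ʳ c j ⟩
      c (k ↑ʳ j) * + p           ≡⟨ cong (_* + p) cⱼ≡0 ⟩
      0ℤ * + p                   ≡⟨ *-zeroˡ (+ p) ⟩
      0ℤ                         ∎)
      where open ≡-Reasoning

lemma4p1 : (p : ℕ) → Prime p → (k r : ℕ) → (B : Fin k → Fin r → ℤ) →
    (j : Fin r) → GΔ≅ℤp^ k r p B (k ↑ʳ j) (r ∸ 1)
lemma4p1 p pp k (suc r) B j = f , additive , (λ x y → mk⇔ (to x y) (from x y)) , surjective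
  where
  Mⱼ = M k (suc r) p B (k ↑ʳ j)

  p≢0 : + p ≢ 0ℤ
  p≢0 p≡0 = ≢-nonZero⁻¹ p {{prime⇒nonZero pp}} (+-injective p≡0)

  f : Mⱼ → ℤVec r
  f (x , _) i = x (k ↑ʳ punchIn j i)

  additive : ∀ (x y s : Mⱼ) → (∀ row → proj₁ s row ≡ proj₁ x row + proj₁ y row) → f s ≡[mod p ] (f x ⊕ f y)
  additive _ _ _ s≡x+y i = ≡⇒∣- (s≡x+y (k ↑ʳ punchIn j i))

  to : ∀ (x y : Mⱼ) → InLattice k (suc r) p B (k ↑ʳ j) (proj₁ x ⊖ proj₁ y) → f x ≡[mod p ] f y
  to _ _ x-y∈L i = InLattice⇒divisible k (suc r) p B j x-y∈L (punchIn j i)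

  from : ∀ (x y : Mⱼ) → f x ≡[mod p ] f y → InLattice k (suc r) p B (k ↑ʳ j) (proj₁ x ⊖ proj₁ y)
  from (x , x∈lin) (y , y∈lin) fx≡fy = divisible⇒InLattice k (suc r) p B j p≢0
    (punchIn-elim j (λ b → + p ∣ (x (k ↑ʳ b) - y (k ↑ʳ b))) (≡⇒∣- xⱼ≡yⱼ) fx≡fy)
    (cong₂ _-_ xⱼ≡0 yⱼ≡0)
    where
    xⱼ≡0 = InLin⇒vanishes k (suc r) p B j x∈lin
    yⱼ≡0 = InLin⇒vanishes k (suc r) p B j y∈lin
    xⱼ≡yⱼ = trans xⱼ≡0 (sym yⱼ≡0)

  -- The preimage of z is z placed into the bottom coordinates other than j; p times it lies in the lattice.
  surjective : ∀ (z : ℤVec r) → Σ Mⱼ λ x → f x ≡[mod p ] z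
  surjective z = (x , + p , p≢0 , divisible⇒InLattice k (suc r) p B j p≢0 p∣px pxⱼ≡0) ,
                 (λ i → ≡⇒∣- (x-punchIn i))
    where
    x : ℤVec (k +ℕ suc r)
    x = (λ _ → 0ℤ) ++ insertAt z j 0ℤ
    p∣px : ∀ b → + p ∣ (+ p * x (k ↑ʳ b))
    p∣px b = quotient⇒∣ (x (k ↑ʳ b)) (*-comm (+ p) _)
    pxⱼ≡0 : + p * x (k ↑ʳ j) ≡ 0ℤ
    pxⱼ≡0 = trans (cong (+ p *_) (trans (lookup-++ʳ {m = k} (λ _ → 0ℤ) (insertAt z j 0ℤ) j) (insertAt-lookup z j 0ℤ))) (*-zeroʳ (+ p))
    x-punchIn : ∀ i → x (k ↑ʳ punchIn j i) ≡ z i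
    x-punchIn i = trans (lookup-++ʳ {m = k} (λ _ → 0ℤ) (insertAt z j 0ℤ) (punchIn j i)) (insertAt-punchIn z j 0ℤ i)
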